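{- Let $n\ge4$ be even. If $C_t$ is a $D$-wave configuration of $H_n$ of length $n$, then in the $\frac12$-power index process on $H_n$ the configuration $C_{t+1}$ is a $C$-wave configuration of length $n$.
   Context: All graphs are finite and simple. A configuration of a graph $G$ is a map $C:V(G)\to\{C,D\}$; vertices with value $C$ are collaborators, those with value $D$ defectors. $N[v]$ is the closed neighbourhood of $v$, $N_C[v]$ is the set of collaborators in $N[v]$ and $N_D[v]$ the set of defectors in $N[v]$. For $w=\frac12$, the power of $v$ is: if $v$ is a collaborator, $p(v)=1/|N_C[v]|$ when $|N_C[v]|/|N[v]|>w$ and $0$ otherwise; if $v$ is a defector, $p(v)=1/|N_D[v]|$ when $|N_C[v]|/|N[v]|\le w$ and $0$ otherwise. The $w$-power index process produces $C_1,C_2,\dots$ from $C_0$: for $t\ge1$ each vertex $v$ simultaneously takes the strategy that, in $C_{t-1}$, is held by the vertex of $N[v]$ of greatest power (computed w.r.t. $C_{t-1}$); if the vertices of $N[v]$ of greatest power have differing strategies, $C_t(v)=C_{t-1}(v)$. The graph $H_n$: start from $C_n\square P_2$ with vertices $v_{i,j}$ ($1\le i\le n$, $j\in\{1,2\}$), where $v_{i,j}\sim v_{i\pm1,j}$ (indices mod $n$) and $v_{i,1}\sim v_{i,2}$; for each $v_{i,j}$ add a triangle on new vertices $x_{i,j},y_{i,j},z_{i,j}$ and the edge $v_{i,j}z_{i,j}$. The configuration $W$ assigns $C$ to $v_{i,1},x_{i,1},y_{i,1},z_{i,1}$ and $D$ to $v_{i,2},x_{i,2},y_{i,2},z_{i,2}$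 for all $i$. A wave configuration of length $n$ is obtained from $W$ by changing the strategy of the vertices in a set $I\subseteq\{v_{1,j},\dots,v_{n,j}\}$ for a single fixed $j$, such that $i_1\equiv i_2 \pmod 2$ whenever $v_{i_1,j},v_{i_2,j}\in I$; the elements of $I$ are its interrupters. It is a $C$-wave configuration if the interrupters are collaborators (i.e. $j=2$) and a $D$-wave configuration if the interrupters are defectors (i.e. $j=1$). -}

module Defs where

open import Data.Bool using (Bool; true; false; if_then_else_; _∧_) renaming (_≟_ to _≟ᵇ_)
open import Data.Nat as ℕ using (ℕ; zero; suc; _%_)
open import Data.Nat.DivMod using (_mod_)
open import Data.Fin using (Fin; toℕ)
open import Data.Integer using (+_)
open import Data.List using (List; []; _∷_; length; filter; foldr; map)
open import Data.Product using (Σ; _×_; _,_)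
open import Data.Rational using (ℚ; _/_; _<_; _⊔_; ½; 0ℚ)
open import Data.Rational.Properties using (_<?_; _≟_)
open import Relation.Nullary.Decidable using (⌊_⌋)
open import Relation.Binary.PropositionalEquality using (_≡_)

data Strat : Set where
  C D : Strat

isC : Strat → Bool
isC C = true
isC D = false

isD : Strat → Bool
isD C = false
isD D = true

flipS : Strat → Strat
flipS C = D
flipS D = C

-- the two copies of C_n (j = 1, 2)
data Layer : Set where
  L1 L2 : Layer

other : Layer → Layer
other L1 = L2
other L2 = L1

-- kind of vertex attached to index (i , j): v_{i,j}, x_{i,j}, y_{i,j}, z_{i,j}
data Kind : Set where
  kv kx ky kz : Kind

-- vertices of H_n; the index i ranges over Fin n (i.e. 0..n-1 instead of 1..n)
HV : ℕ → Set
HV n = Fin n × Layer × Kind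

next : ∀ {n} → Fin n → Fin n
next {suc m} i = suc (toℕ i) mod suc m

prev : ∀ {n} → Fin n → Fin n
prev {suc m} i = (toℕ i ℕ.+ m) mod suc m

nbrs : ∀ {n} → HV n → List (HV n)
nbrs (i , j , kv) = (next i , j , kv) ∷ (prev i , j , kv) ∷ (i , other j , kv) ∷ (i , j , kz) ∷ []
nbrs (i , j , kx) = (i , j , ky) ∷ (i , j , kz) ∷ []
nbrs (i , j , ky) = (i , j , kx) ∷ (i , j , kz) ∷ []
nbrs (i , j , kz) = (i , j , kx) ∷ (i , j , ky) ∷ (i , j , kv) ∷ []

cnbhd : ∀ {n} → HV n → List (HV n)
cnbhd v = v ∷ nbrs v

Config : ℕ → Set
Config n = HV n → Strat

-- 1/k (and 0 for k = 0, which never occurs where used)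
inv : ℕ → ℚ
inv zero    = 0ℚ
inv (suc k) = + 1 / suc k

nC : ∀ {n} → Config n → HV n → ℕ
nC c v = length (filter (λ u → isC (c u) ≟ᵇ true) (cnbhd v))

nD : ∀ {n} → Config n → HV n → ℕ
nD c v = length (filter (λ u → isD (c u) ≟ᵇ true) (cnbhd v))

ratioC : ∀ {n} → Config n → HV n → ℚ
ratioC c v = + nC c v / suc (length (nbrs v))

power : ∀ {n} → Config n → HV n → ℚ
power c v with c v
... | C = if ⌊ ½ <? ratioC c v ⌋ then inv (nC c v) else 0ℚ
... | D = if ⌊ ½ <? ratioC c v ⌋ then 0ℚ else inv (nD c v)

maxPower : ∀ {n} → Config n → HV n → ℚ
maxPower c v = foldr _⊔_ (power c v) (map (power c) (nbrs v))

winners : ∀ {n} → Config n → HV n → List (HV n)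
winners c v = filter (λ u → power c u ≟ maxPower c v) (cnbhd v)

allB : {A : Set} → (A → Bool) → List A → Bool
allB p []       = true
allB p (x ∷ xs) = p x ∧ allB p xs

step : ∀ {n} → Config n → Config n
step c v =
  if allB (λ u → isC (c u)) (winners c v) then C
  else if allB (λ u → isD (c u)) (winners c v) then D
  else c v

W : ∀ {n} → Config n
W (i , L1 , k) = C
W (i , L2 , k) = D

sameLayer : Layer → Layer → Bool
sameLayer L1 L1 = true
sameLayer L2 L2 = true
sameLayer _  _  = false

waveFrom : ∀ {n} → (Fin n → Bool) → Layer → Config n
waveFrom I j (i , j' , kv) =
  if I i ∧ sameLayer j j' then flipS (W (i , j' , kv)) else W (i , j' , kv)
waveFrom I j u = W u

IsWaveOn : ∀ {n} → Layer → Config n → Set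
IsWaveOn {n} j c =
  Σ (Fin n → Bool) λ I →
    (∀ i₁ i₂ → I i₁ ≡ true → I i₂ ≡ true → toℕ i₁ % 2 ≡ toℕ i₂ % 2)
    × (∀ u → c u ≡ waveFrom I j u)

-- D-wave: interrupters are defectors, i.e. j = 1
IsDWave : ∀ {n} → Config n → Set
IsDWave = IsWaveOn L1

-- C-wave: interrupters are collaborators, i.e. j = 2
IsCWave : ∀ {n} → Config n → Set
IsCWave = IsWaveOn L2

-- Let c be the D-wave on H_n whose interrupters are the v_{i,1} with I i.
-- The idea is that every quantity of the process is local: the power of a
-- vertex is a function of the strategies on its closed neighbourhood, and
-- its update is a function of the strategies and powers there.  In the
-- wave, the strategy of a vertex with index i is determined by the bit I i,
-- so the power of a vertex with index i is a closed function of the bits at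
-- i-1, i, i+1 and its new strategy a closed function of the bits at
-- i-2, ..., i+2.  Since n is even and all interrupters have the same parity,
-- no two interrupters are adjacent; for all such windows of five bits a
-- finite computation shows that the whole of layer 1 becomes C, that
-- x, y, z of layer 2 stay D, and that v_{i,2} becomes C exactly when one of
-- v_{i-1,1}, v_{i+1,1} was an interrupter.  These v_{i,2} then all have the
-- parity opposite to the old interrupters, so the result is a C-wave.

module Submission where

open import Defs
open import Data.Nat using (ℕ; _≤_; zero; suc; _+_; _%_)
open import Data.Nat.Divisibility using (_∣_)
open import Data.Bool using (Bool; true; false; if_then_else_; _∧_; _xor_) renaming (_≟_ to _≟ᵇ_)
open import Data.Bool.Properties using (∧-comm)
open import Data.Nat.Properties using (+-suc; +-comm)
open import Data.Nat.DivMod using (%-distribˡ-+; m%n%n≡m%n; [m+n]%n≡m%n; m<n⇒m%n≡m; m∣n⇒o%n%m≡o%m)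
open import Data.Fin using (Fin; toℕ)
open import Data.Fin.Properties using (toℕ-injective; toℕ-fromℕ<; toℕ<n)
open import Data.Integer using (+_)
open import Data.List using (List; []; _∷_; length; filter; foldr; map)
open import Data.List.Properties using (length-map; map-cong)
open import Data.List.Relation.Binary.Pointwise using (Pointwise-≡⇒≡; []; _∷_)
open import Data.Product using (∃; _×_; _,_)
open import Data.Rational using (ℚ; _/_; _⊔_; ½; 0ℚ)
open import Data.Rational.Properties using (_<?_; _≟_)
open import Data.Empty using (⊥-elim)
open import Relation.Nullary using (does)
open import Relation.Nullary.Decidable using (⌊_⌋)
open import Relation.Binary.PropositionalEquality using (_≡_; _≢_; refl; sym; trans; subst; cong; cong₂; module ≡-Reasoning)

open ≡-Reasoning

count : (Strat → Bool) → List Strat → ℕ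
count p ss = length (filter (λ s → p s ≟ᵇ true) ss)

powerOf : Strat → ℕ → ℕ → ℕ → ℚ
powerOf C k l d = if ⌊ ½ <? (+ k / suc d) ⌋ then inv k else 0ℚ
powerOf D k l d = if ⌊ ½ <? (+ k / suc d) ⌋ then 0ℚ else inv l

powerRule : Strat → List Strat → ℚ
powerRule s ss = powerOf s (count isC (s ∷ ss)) (count isD (s ∷ ss)) (length ss)

winning : ℚ → List Strat → List ℚ → List Strat
winning M (s ∷ ss) (p ∷ ps) = if does (p ≟ M) then s ∷ winning M ss ps else winning M ss ps
winning M _        _        = []

updateRule : Strat → ℚ → List Strat → List ℚ → Strat
updateRule s p ss ps =
  if allB isC ws then C else if allB isD ws then D else s
  where ws = winning (foldr _⊔_ p ps) (s ∷ ss) (p ∷ ps)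

powerOf-cong : ∀ s {k k' l l' d d'} → k ≡ k' → l ≡ l' → d ≡ d' → powerOf s k l d ≡ powerOf s k' l' d'
powerOf-cong s refl refl refl = refl

update-cong : ∀ {s s' p p' ss ss' ps ps'} → s ≡ s' → p ≡ p' → ss ≡ ss' → ps ≡ ps' →
  updateRule s p ss ps ≡ updateRule s' p' ss' ps'
update-cong refl refl refl refl = refl

module _ {A : Set} (c : A → Strat) where

  count-map : ∀ p xs → length (filter (λ u → p (c u) ≟ᵇ true) xs) ≡ count p (map c xs)
  count-map p []       = refl
  count-map p (x ∷ xs) with p (c x)
  ... | true  = cong suc (count-map p xs)
  ... | false = count-map p xs

  allB-winning : ∀ (P : A → ℚ) (g : Strat → Bool) M xs →
    allB (λ u → g (c u)) (filter (λ u → P u ≟ M) xs) ≡ allB g (winning M (map c xs) (map P xs))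
  allB-winning P g M []       = refl
  allB-winning P g M (x ∷ xs) with does (P x ≟ M)
  ... | true  = cong (g (c x) ∧_) (allB-winning P g M xs)
  ... | false = allB-winning P g M xs

count-closed : ∀ {n} (c : Config n) u {s} → c u ≡ s → ∀ p →
  length (filter (λ v → p (c v) ≟ᵇ true) (cnbhd u)) ≡ count p (s ∷ map c (nbrs u))
count-closed c u eq p = trans (count-map c p (cnbhd u)) (cong (λ s → count p (s ∷ map c (nbrs u))) eq)

power-local : ∀ {n} (c : Config n) u → power c u ≡ powerRule (c u) (map c (nbrs u))
power-local c u with c u in eq
... | C = powerOf-cong C (count-closed c u eq isC) (count-closed c u eq isD) (sym (length-map c (nbrs u)))
... | D = powerOf-cong D (count-closed c u eq isC) (count-closed c u eq isD) (sym (length-map c (nbrs u)))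

step-local : ∀ {n} (c : Config n) v →
  step c v ≡ updateRule (c v) (power c v) (map c (nbrs v)) (map (power c) (nbrs v))
step-local c v = cong₂ (λ a b → if a then C else if b then D else c v)
  (allB-winning c (power c) isC (maxPower c v) (cnbhd v))
  (allB-winning c (power c) isD (maxPower c v) (cnbhd v))

step-cong : ∀ {n} {c c' : Config n} → (∀ u → c u ≡ c' u) → ∀ v → step c v ≡ step c' v
step-cong {c = c} {c'} c≗c' v = begin
  step c v                                                          ≡⟨ step-local c v ⟩
  updateRule (c v) (power c v) (map c (nbrs v)) (map (power c) (nbrs v))
    ≡⟨ update-cong (c≗c' v) (power≗ v) (map-cong c≗c' (nbrs v)) (map-cong power≗ (nbrs v)) ⟩
  updateRule (c' v) (power c' v) (map c' (nbrs v)) (map (power c') (nbrs v)) ≡⟨ sym (step-local c' v) ⟩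
  step c' v                                                         ∎
  where
  power≗ : ∀ u → power c u ≡ power c' u
  power≗ u = trans (power-local c u)
    (trans (cong₂ powerRule (c≗c' u) (map-cong c≗c' (nbrs u))) (sym (power-local c' u)))

%-absorb : ∀ a k {N} → (a % suc N + k) % suc N ≡ (a + k) % suc N
%-absorb a k {N} = begin
  (a % suc N + k) % suc N                  ≡⟨ %-distribˡ-+ (a % suc N) k (suc N) ⟩
  (a % suc N % suc N + k % suc N) % suc N  ≡⟨ cong (λ r → (r + k % suc N) % suc N) (m%n%n≡m%n a (suc N)) ⟩
  (a % suc N + k % suc N) % suc N          ≡⟨ sym (%-distribˡ-+ a k (suc N)) ⟩
  (a + k) % suc N                          ∎

%-wrap : ∀ {N} (i : Fin (suc N)) → (toℕ i + suc N) % suc N ≡ toℕ i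
%-wrap {N} i = trans ([m+n]%n≡m%n (toℕ i) (suc N)) (m<n⇒m%n≡m (toℕ<n i))

toℕ-next : ∀ {m} (i : Fin (suc m)) → toℕ (next i) ≡ suc (toℕ i) % suc m
toℕ-next i = toℕ-fromℕ< _

toℕ-prev : ∀ {m} (i : Fin (suc m)) → toℕ (prev i) ≡ (toℕ i + m) % suc m
toℕ-prev i = toℕ-fromℕ< _

prev-next : ∀ {m} (i : Fin (suc m)) → prev (next i) ≡ i
prev-next {m} i = toℕ-injective (begin
  toℕ (prev (next i))                ≡⟨ toℕ-prev (next i) ⟩
  (toℕ (next i) + m) % suc m         ≡⟨ cong (λ r → (r + m) % suc m) (toℕ-next i) ⟩
  (suc (toℕ i) % suc m + m) % suc m  ≡⟨ %-absorb (suc (toℕ i)) m {m} ⟩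
  (suc (toℕ i) + m) % suc m          ≡⟨ cong (_% suc m) (sym (+-suc (toℕ i) m)) ⟩
  (toℕ i + suc m) % suc m            ≡⟨ %-wrap i ⟩
  toℕ i                              ∎)

next-prev : ∀ {m} (i : Fin (suc m)) → next (prev i) ≡ i
next-prev {m} i = toℕ-injective (begin
  toℕ (next (prev i))                ≡⟨ toℕ-next (prev i) ⟩
  suc (toℕ (prev i)) % suc m         ≡⟨ cong (λ r → suc r % suc m) (toℕ-prev i) ⟩
  suc ((toℕ i + m) % suc m) % suc m  ≡⟨ cong (_% suc m) (+-comm 1 _) ⟩
  ((toℕ i + m) % suc m + 1) % suc m  ≡⟨ %-absorb (toℕ i + m) 1 {m} ⟩
  (toℕ i + m + 1) % suc m            ≡⟨ cong (_% suc m) (trans (+-comm _ 1) (sym (+-suc (toℕ i) m))) ⟩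
  (toℕ i + suc m) % suc m            ≡⟨ %-wrap i ⟩
  toℕ i                              ∎)

parity-suc : ∀ a → suc a % 2 ≢ a % 2
parity-suc zero                ()
parity-suc (suc zero)          ()
parity-suc (suc (suc a)) eq = parity-suc a eq

parity-other : ∀ a r → a % 2 ≢ r % 2 → a % 2 ≡ suc r % 2
parity-other zero          zero          a≢r = ⊥-elim (a≢r refl)
parity-other zero          (suc zero)    a≢r = refl
parity-other (suc zero)    zero          a≢r = refl
parity-other (suc zero)    (suc zero)    a≢r = ⊥-elim (a≢r refl)
parity-other (suc (suc a)) r             a≢r = parity-other a r a≢r
parity-other a             (suc (suc r)) a≢r = parity-other a r a≢r

parity-opposite : ∀ a b r → a % 2 ≢ r % 2 → b % 2 ≢ r % 2 → a % 2 ≡ b % 2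
parity-opposite a b r a≢r b≢r = trans (parity-other a r a≢r) (sym (parity-other b r b≢r))

module EvenCycle {m : ℕ} (even : 2 ∣ suc m) where

  parity-next : ∀ (i : Fin (suc m)) → toℕ (next i) % 2 ≢ toℕ i % 2
  parity-next i eq = parity-suc (toℕ i) (trans (sym next%2) eq)
    where
    next%2 : toℕ (next i) % 2 ≡ suc (toℕ i) % 2
    next%2 = trans (cong (_% 2) (toℕ-next i)) (m∣n⇒o%n%m≡o%m 2 (suc m) (suc (toℕ i)) even)

  parity-prev : ∀ (i : Fin (suc m)) → toℕ (prev i) % 2 ≢ toℕ i % 2
  parity-prev i eq = parity-next (prev i) (trans (cong (λ j → toℕ j % 2) (next-prev i)) (sym eq))

base : Layer → Strat
base L1 = C
base L2 = D

waveStrat : Layer → Layer → Kind → Bool → Strat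
waveStrat jI j kv β = if sameLayer jI j ∧ β then flipS (base j) else base j
waveStrat jI j _  β = base j

waveFrom-at : ∀ {n} (I : Fin n → Bool) jI i j k → waveFrom I jI (i , j , k) ≡ waveStrat jI j k (I i)
waveFrom-at I jI i L1 kv = cong (λ b → if b then D else C) (∧-comm (I i) (sameLayer jI L1))
waveFrom-at I jI i L2 kv = cong (λ b → if b then C else D) (∧-comm (I i) (sameLayer jI L2))
waveFrom-at I jI i L1 kx = refl
waveFrom-at I jI i L1 ky = refl
waveFrom-at I jI i L1 kz = refl
waveFrom-at I jI i L2 kx = refl
waveFrom-at I jI i L2 ky = refl
waveFrom-at I jI i L2 kz = refl

-- In a D-wave, the vertex (i , j , k) sees the bits b, x, d at i-1, i, i+1
-- and, through the powers of its neighbours, the bits a, e at i-2, i+2.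

dStrat : Layer → Kind → Bool → Strat
dStrat = waveStrat L1

localStrats : Layer → Kind → Bool → Bool → Bool → List Strat
localStrats j kv b x d = dStrat j kv d ∷ dStrat j kv b ∷ dStrat (other j) kv x ∷ dStrat j kz x ∷ []
localStrats j kx b x d = dStrat j ky x ∷ dStrat j kz x ∷ []
localStrats j ky b x d = dStrat j kx x ∷ dStrat j kz x ∷ []
localStrats j kz b x d = dStrat j kx x ∷ dStrat j ky x ∷ dStrat j kv x ∷ []

localPower : Layer → Kind → Bool → Bool → Bool → ℚ
localPower j k b x d = powerRule (dStrat j k x) (localStrats j k b x d)

localPowers : Layer → Kind → Bool → Bool → Bool → Bool → Bool → List ℚ
localPowers j kv a b x d e =
  localPower j kv x d e ∷ localPower j kv a b x ∷ localPower (other j) kv b x d ∷ localPower j kz b x d ∷ []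
localPowers j kx a b x d e = localPower j ky b x d ∷ localPower j kz b x d ∷ []
localPowers j ky a b x d e = localPower j kx b x d ∷ localPower j kz b x d ∷ []
localPowers j kz a b x d e = localPower j kx b x d ∷ localPower j ky b x d ∷ localPower j kv b x d ∷ []

localStep : Layer → Kind → Bool → Bool → Bool → Bool → Bool → Strat
localStep j k a b x d e =
  updateRule (dStrat j k x) (localPower j k b x d) (localStrats j k b x d) (localPowers j k a b x d e)

module DWave {m : ℕ} (I : Fin (suc m) → Bool) where

  wave : Config (suc m)
  wave = waveFrom I L1

  bitStrat : HV (suc m) → Strat
  bitStrat (i , j , k) = dStrat j k (I i)

  wave≗bitStrat : ∀ u → wave u ≡ bitStrat u
  wave≗bitStrat (i , j , k) = waveFrom-at I L1 i j k

  neighbour-strats : ∀ i j k → map wave (nbrs (i , j , k)) ≡ localStrats j k (I (prev i)) (I i) (I (next i))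
  neighbour-strats i j kv = map-cong wave≗bitStrat (nbrs (i , j , kv))
  neighbour-strats i j kx = map-cong wave≗bitStrat (nbrs (i , j , kx))
  neighbour-strats i j ky = map-cong wave≗bitStrat (nbrs (i , j , ky))
  neighbour-strats i j kz = map-cong wave≗bitStrat (nbrs (i , j , kz))

  power-wave : ∀ i j k → power wave (i , j , k) ≡ localPower j k (I (prev i)) (I i) (I (next i))
  power-wave i j k = trans (power-local wave (i , j , k))
    (cong₂ powerRule (wave≗bitStrat (i , j , k)) (neighbour-strats i j k))

  power-next : ∀ i j → power wave (next i , j , kv) ≡ localPower j kv (I i) (I (next i)) (I (next (next i)))
  power-next i j = trans (power-wave (next i) j kv)
    (cong (λ β → localPower j kv (I β) (I (next i)) (I (next (next i)))) (prev-next i))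

  power-prev : ∀ i j → power wave (prev i , j , kv) ≡ localPower j kv (I (prev (prev i))) (I (prev i)) (I i)
  power-prev i j = trans (power-wave (prev i) j kv)
    (cong (λ β → localPower j kv (I (prev (prev i))) (I (prev i)) (I β)) (next-prev i))

  neighbour-powers : ∀ i j k → map (power wave) (nbrs (i , j , k)) ≡
    localPowers j k (I (prev (prev i))) (I (prev i)) (I i) (I (next i)) (I (next (next i)))
  neighbour-powers i j kv = Pointwise-≡⇒≡
    (power-next i j ∷ power-prev i j ∷ power-wave i (other j) kv ∷ power-wave i j kz ∷ [])
  neighbour-powers i j kx = Pointwise-≡⇒≡ (power-wave i j ky ∷ power-wave i j kz ∷ [])
  neighbour-powers i j ky = Pointwise-≡⇒≡ (power-wave i j kx ∷ power-wave i j kz ∷ [])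
  neighbour-powers i j kz = Pointwise-≡⇒≡ (power-wave i j kx ∷ power-wave i j ky ∷ power-wave i j kv ∷ [])

  step-wave : ∀ i j k → step wave (i , j , k) ≡
    localStep j k (I (prev (prev i))) (I (prev i)) (I i) (I (next i)) (I (next (next i)))
  step-wave i j k = trans (step-local wave (i , j , k))
    (update-cong (wave≗bitStrat (i , j , k)) (power-wave i j k) (neighbour-strats i j k) (neighbour-powers i j k))

-- the bits p and q are not both set; this holds for adjacent positions
Apart : Bool → Bool → Set
Apart p q = p ∧ q ≡ false

rule-v₁ : ∀ a b x d e → Apart a b → Apart b x → Apart x d → Apart d e → localStep L1 kv a b x d e ≡ C
rule-v₁ true  true  x     d     e     () _  _  _
rule-v₁ a     true  true  d     e     _  () _  _
rule-v₁ a     b     true  true  e     _  _  () _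
rule-v₁ a     b     x     true  true  _  _  _  ()
rule-v₁ false false false false false _  _  _  _  = refl
rule-v₁ false false false false true  _  _  _  _  = refl
rule-v₁ false false false true  false _  _  _  _  = refl
rule-v₁ false false true  false false _  _  _  _  = refl
rule-v₁ false false true  false true  _  _  _  _  = refl
rule-v₁ false true  false false false _  _  _  _  = refl
rule-v₁ false true  false false true  _  _  _  _  = refl
rule-v₁ false true  false true  false _  _  _  _  = refl
rule-v₁ true  false false false false _  _  _  _  = refl
rule-v₁ true  false false false true  _  _  _  _  = refl
rule-v₁ true  false false true  false _  _  _  _  = refl
rule-v₁ true  false true  false false _  _  _  _  = refl
rule-v₁ true  false true  false true  _  _  _  _  = refl

rule-z₁ : ∀ a b x d e → Apart b x → Apart x d → localStep L1 kz a b x d e ≡ C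
rule-z₁ a true  true  d     e () _
rule-z₁ a b     true  true  e _  ()
rule-z₁ a false false false e _  _  = refl
rule-z₁ a false false true  e _  _  = refl
rule-z₁ a false true  false e _  _  = refl
rule-z₁ a true  false false e _  _  = refl
rule-z₁ a true  false true  e _  _  = refl

rule-x₁ : ∀ a b x d e → localStep L1 kx a b x d e ≡ C
rule-x₁ a b false d e = refl
rule-x₁ a b true  d e = refl

rule-y₁ : ∀ a b x d e → localStep L1 ky a b x d e ≡ C
rule-y₁ a b false d e = refl
rule-y₁ a b true  d e = refl

rule-v₂ : ∀ a b x d e → Apart b x → Apart x d → localStep L2 kv a b x d e ≡ waveStrat L2 L2 kv (d xor b)
rule-v₂ a true  true  d     e () _
rule-v₂ a b     true  true  e _  ()
rule-v₂ a false false false e _  _  = refl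
rule-v₂ a false false true  e _  _  = refl
rule-v₂ a false true  false e _  _  = refl
rule-v₂ a true  false false e _  _  = refl
rule-v₂ a true  false true  e _  _  = refl

rule-z₂ : ∀ a b x d e → localStep L2 kz a b x d e ≡ D
rule-z₂ a b false d e = refl
rule-z₂ a b true  d e = refl

rule-x₂ : ∀ a b x d e → localStep L2 kx a b x d e ≡ D
rule-x₂ a b x d e = refl

rule-y₂ : ∀ a b x d e → localStep L2 ky a b x d e ≡ D
rule-y₂ a b x d e = refl

local-rule : ∀ j k a b x d e → Apart a b → Apart b x → Apart x d → Apart d e →
  localStep j k a b x d e ≡ waveStrat L2 j k (d xor b)
local-rule L1 kv a b x d e ab bx xd de = rule-v₁ a b x d e ab bx xd de
local-rule L1 kx a b x d e ab bx xd de = rule-x₁ a b x d e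
local-rule L1 ky a b x d e ab bx xd de = rule-y₁ a b x d e
local-rule L1 kz a b x d e ab bx xd de = rule-z₁ a b x d e bx xd
local-rule L2 kv a b x d e ab bx xd de = rule-v₂ a b x d e bx xd
local-rule L2 kx a b x d e ab bx xd de = rule-x₂ a b x d e
local-rule L2 ky a b x d e ab bx xd de = rule-y₂ a b x d e
local-rule L2 kz a b x d e ab bx xd de = rule-z₂ a b x d e

module Interrupters {m : ℕ} (even : 2 ∣ suc m) (I : Fin (suc m) → Bool)
  (sameParity : ∀ i₁ i₂ → I i₁ ≡ true → I i₂ ≡ true → toℕ i₁ % 2 ≡ toℕ i₂ % 2) where

  open EvenCycle even
  open DWave I

  -- neighbours have different parity, so they are not both interrupters
  apart-next : ∀ i → Apart (I i) (I (next i))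
  apart-next i with I i in e | I (next i) in e'
  ... | true  | true  = ⊥-elim (parity-next i (sameParity (next i) i e' e))
  ... | true  | false = refl
  ... | false | _     = refl

  apart-prev : ∀ i → Apart (I (prev i)) (I i)
  apart-prev i = subst (λ j → Apart (I (prev i)) (I j)) (next-prev i) (apart-next (prev i))

  nextInterrupters : Fin (suc m) → Bool
  nextInterrupters i = I (next i) xor I (prev i)

  beside-interrupter : ∀ i → nextInterrupters i ≡ true → ∃ λ j → I j ≡ true × toℕ j % 2 ≢ toℕ i % 2
  beside-interrupter i h with I (next i) in e | I (prev i) in e'
  ... | true  | _     = next i , e , parity-next i
  ... | false | true  = prev i , e' , parity-prev i
  beside-interrupter i () | false | false

  nextInterrupters-parity : ∀ i₁ i₂ → nextInterrupters i₁ ≡ true → nextInterrupters i₂ ≡ true →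
    toℕ i₁ % 2 ≡ toℕ i₂ % 2
  nextInterrupters-parity i₁ i₂ h₁ h₂ with beside-interrupter i₁ h₁ | beside-interrupter i₂ h₂
  ... | j₁ , Ij₁ , j₁≢i₁ | j₂ , Ij₂ , j₂≢i₂ =
    parity-opposite (toℕ i₁) (toℕ i₂) (toℕ j₁) (λ e → j₁≢i₁ (sym e))
      (λ e → j₂≢i₂ (trans (sym (sameParity j₁ j₂ Ij₁ Ij₂)) (sym e)))

  wave-step : ∀ u → step wave u ≡ waveFrom nextInterrupters L2 u
  wave-step (i , j , k) = begin
    step wave (i , j , k)                  ≡⟨ step-wave i j k ⟩
    localStep j k (I (prev (prev i))) (I (prev i)) (I i) (I (next i)) (I (next (next i)))
      ≡⟨ local-rule j k _ _ _ _ _ (apart-prev (prev i)) (apart-prev i) (apart-next i) (apart-next (next i)) ⟩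
    waveStrat L2 j k (nextInterrupters i)  ≡⟨ sym (waveFrom-at nextInterrupters L2 i j k) ⟩
    waveFrom nextInterrupters L2 (i , j , k) ∎

-- c agrees with the D-wave of I, so its successor is that of the wave, which
-- is the C-wave of nextInterrupters
mainTheorem10 : (n : ℕ) → 4 ≤ n → 2 ∣ n →
    (c : Config n) → IsDWave c → IsCWave (step c)
mainTheorem10 zero    () _ _ _
mainTheorem10 (suc m) _  even c (I , sameParity , c≗wave) =
  nextInterrupters , nextInterrupters-parity , λ u → trans (step-cong c≗wave u) (wave-step u)
  where open Interrupters even I sameParity
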